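{- Let $H_1$ be an $r_1$-uniform critical hypergraph and $H_2$ an $r_2$-uniform critical hypergraph. Then there exists an $r_1r_2$-uniform critical hypergraph with $|V(H_1)|\cdot|V(H_2)|$ vertices and $|E(H_1)|\cdot|E(H_2)|^{r_1}$ edges.
   Context: A hypergraph is $r$-uniform if all edges have exactly $r$ vertices; it is intersecting if any two edges intersect; its cover number is the minimum size of a vertex set meeting every edge. An $r$-uniform hypergraph is called critical if it is intersecting and has cover number equal to $r$. -}

module Defs where

open import Data.Nat using (ℕ; _≤_; _*_; _^_)
open import Data.Fin.Subset using (Subset; ∣_∣; _∩_; Nonempty)
open import Data.List using (List; length)
open import Data.List.Membership.Propositional using (_∈_)
open import Data.List.Relation.Unary.Unique.Propositional using (Unique)
open import Data.Product using (Σ; _×_)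
open import Relation.Binary.PropositionalEquality using (_≡_)

record Hypergraph : Set where
  field
    nV     : ℕ
    edges  : List (Subset nV)
    simple : Unique edges
open Hypergraph public

∣V∣ : Hypergraph → ℕ
∣V∣ H = nV H

∣E∣ : Hypergraph → ℕ
∣E∣ H = length (edges H)

Uniform : ℕ → Hypergraph → Set
Uniform r H = ∀ e → e ∈ edges H → ∣ e ∣ ≡ r

Intersecting : Hypergraph → Set
Intersecting H = ∀ e f → e ∈ edges H → f ∈ edges H → Nonempty (e ∩ f)

IsCover : (H : Hypergraph) → Subset (nV H) → Set
IsCover H C = ∀ e → e ∈ edges H → Nonempty (C ∩ e)

CoverNumber≡ : Hypergraph → ℕ → Set
CoverNumber≡ H t =
  Σ (Subset (nV H)) (λ C → IsCover H C × ∣ C ∣ ≡ t)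
  × (∀ C → IsCover H C → t ≤ ∣ C ∣)

Critical : ℕ → Hypergraph → Set
Critical r H = Uniform r H × Intersecting H × CoverNumber≡ H r

-- The product lives on V₁ × V₂: for every edge e of H₁ and every choice of an edge f_v of H₂
-- for each v ∈ e, the set ⋃_{v ∈ e} {v} × f_v is an edge.  Two such edges meet in a row v lying in
-- both edges of H₁, where the chosen edges of H₂ meet; and if Cᵢ is a minimum cover of Hᵢ, then
-- C₁ × C₂ is a cover of size r₁ r₂.  Conversely, given a cover C, let A be the set of v whose row
-- C_v = {w ∣ (v , w) ∈ C} covers H₂, so that |C| ≥ |A| r₂.  If A missed an edge e of H₁, choosing
-- for each v ∈ e an edge f_v of H₂ missed by C_v would give an edge missed by C; so |A| ≥ r₁.
module Submission where

open import Defs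
open import Level using (Level)
open import Data.Bool using (Bool; true; false; if_then_else_)
open import Data.Fin using (Fin; zero; suc)
open import Data.Fin.Subset using (Subset; ∣_∣; _∩_; _∈_; _∉_; Nonempty; Empty; ⊥)
open import Data.Fin.Subset.Properties using (∣⊥∣≡0; ∉⊥; nonempty?; x∈p∩q⁺; x∈p∩q⁻; p∩q⊆p; p∩q⊆q)
open import Data.List as List using (List; []; _∷_; [_]; length; concatMap; cartesianProductWith)
open import Data.List.Properties using (length-map; length-++)
import Data.List.Membership.Propositional as List
open import Data.List.Membership.Propositional using (find; lose)
open import Data.List.Membership.Propositional.Properties
  using (∈-map⁺; ∈-map⁻; ∈-concatMap⁺; ∈-concatMap⁻; ∈-cartesianProductWith⁺; ∈-cartesianProductWith⁻)
open import Data.List.Relation.Unary.Any using (here; there)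
open import Data.List.Relation.Unary.All as All using (All; all?)
import Data.List.Relation.Unary.All.Properties as Allₚ
import Data.List.Relation.Unary.AllPairs as AllPairs
import Data.List.Relation.Unary.AllPairs.Properties as AllPairsₚ
open import Data.List.Relation.Unary.Unique.Propositional using (Unique)
import Data.List.Relation.Unary.Unique.Propositional.Properties as Uniqueₚ
open import Data.List.Relation.Binary.Disjoint.Propositional using (Disjoint)
open import Data.Nat using (ℕ; _+_; _*_; _^_; _≤_; suc; z≤n)
open import Data.Nat.Properties using (+-identityʳ; +-mono-≤; m≤n⇒m≤o+n; *-monoˡ-≤; ≤-trans)
open import Data.Product as Product using (Σ; ∃; ∃₂; _×_; _,_)
open import Data.Sum as Sum using (_⊎_; inj₁; inj₂)
import Data.Vec as Vec
open import Data.Vec using (Vec; []; _∷_; here; there; _++_; concat; lookup; group)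
open import Data.Vec.Properties using (∷-injective; ++-injective; zipWith-++)
open import Data.Vec.Relation.Binary.Pointwise.Inductive using (Pointwise; []; _∷_)
open import Function using (_∘_)
open import Relation.Unary using (Decidable)
open import Relation.Nullary using (¬_; yes; no; does; contradiction)
import Relation.Nullary.Decidable as Dec
open import Relation.Binary.PropositionalEquality using (_≡_; _≢_; refl; trans; cong; cong₂; subst)
open Relation.Binary.PropositionalEquality.≡-Reasoning

private
  variable
    a b c : Level
    A : Set a
    B : Set b
    C : Set c
    m n r : ℕ
    F G : List (Subset n)
    e e′ : Subset m
    M N : Vec (Subset n) m

length-cartesianProductWith : (f : A → B → C) (xs : List A) (ys : List B) →
                              length (cartesianProductWith f xs ys) ≡ length xs * length ys
length-cartesianProductWith f []       ys = refl
length-cartesianProductWith f (x ∷ xs) ys = begin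
  length (List.map (f x) ys List.++ cartesianProductWith f xs ys)
    ≡⟨ length-++ (List.map (f x) ys) ⟩
  length (List.map (f x) ys) + length (cartesianProductWith f xs ys)
    ≡⟨ cong₂ _+_ (length-map (f x) ys) (length-cartesianProductWith f xs ys) ⟩
  length ys + length xs * length ys ∎

length-concatMap : (f : A → List B) (xs : List A) →
                   (∀ {x} → x List.∈ xs → length (f x) ≡ n) → length (concatMap f xs) ≡ length xs * n
length-concatMap f []       _     = refl
length-concatMap f (x ∷ xs) ∣f∣≡n =
  trans (length-++ (f x)) (cong₂ _+_ (∣f∣≡n (here refl)) (length-concatMap f xs (∣f∣≡n ∘ there)))

∣p++q∣≡∣p∣+∣q∣ : (p : Subset m) (q : Subset n) → ∣ p ++ q ∣ ≡ ∣ p ∣ + ∣ q ∣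
∣p++q∣≡∣p∣+∣q∣ []          q = refl
∣p++q∣≡∣p∣+∣q∣ (true ∷ p)  q = cong suc (∣p++q∣≡∣p∣+∣q∣ p q)
∣p++q∣≡∣p∣+∣q∣ (false ∷ p) q = ∣p++q∣≡∣p∣+∣q∣ p q

Nonempty-++⁺ˡ : {p : Subset m} {q : Subset n} → Nonempty p → Nonempty (p ++ q)
Nonempty-++⁺ˡ (zero  , here)     = zero , here
Nonempty-++⁺ˡ (suc x , there x∈) = Product.map suc there (Nonempty-++⁺ˡ (x , x∈))

Nonempty-++⁺ʳ : (p : Subset m) {q : Subset n} → Nonempty q → Nonempty (p ++ q)
Nonempty-++⁺ʳ []      ne = ne
Nonempty-++⁺ʳ (_ ∷ p) ne = Product.map suc there (Nonempty-++⁺ʳ p ne)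

Nonempty-++⁻ : (p : Subset m) {q : Subset n} → Nonempty (p ++ q) → Nonempty p ⊎ Nonempty q
Nonempty-++⁻ []      ne                 = inj₂ ne
Nonempty-++⁻ (_ ∷ p) (zero  , here)     = inj₁ (zero , here)
Nonempty-++⁻ (_ ∷ p) (suc x , there x∈) = Sum.map₁ (Product.map suc there) (Nonempty-++⁻ p (x , x∈))

∩-++ : (p p′ : Subset m) (q q′ : Subset n) → (p ++ q) ∩ (p′ ++ q′) ≡ (p ∩ p′) ++ (q ∩ q′)
∩-++ p p′ q q′ = zipWith-++ _ p q p′ q′

Empty-∩-++ : {p p′ : Subset m} {q q′ : Subset n} →
             Empty (p ∩ p′) → Empty (q ∩ q′) → Empty ((p ++ q) ∩ (p′ ++ q′))
Empty-∩-++ {p = p} {p′} {q} {q′} p∩p′-empty q∩q′-empty =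
  Sum.[ p∩p′-empty , q∩q′-empty ]′ ∘ Nonempty-++⁻ (p ∩ p′) ∘ subst Nonempty (∩-++ p p′ q q′)

concat-injective : (M N : Vec (Subset n) m) → concat M ≡ concat N → M ≡ N
concat-injective []      []      _  = refl
concat-injective (p ∷ M) (q ∷ N) eq with refl , eq′ ← ++-injective p q eq =
  cong (p ∷_) (concat-injective M N eq′)

concat-meets : (M N : Vec (Subset n) m) (i : Fin m) →
               Nonempty (lookup M i ∩ lookup N i) → Nonempty (concat M ∩ concat N)
concat-meets (p ∷ M) (q ∷ N) zero    ne rewrite ∩-++ p q (concat M) (concat N) =
  Nonempty-++⁺ˡ ne
concat-meets (p ∷ M) (q ∷ N) (suc i) ne rewrite ∩-++ p q (concat M) (concat N) =
  Nonempty-++⁺ʳ (p ∩ q) (concat-meets M N i ne)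

-- Subsets of Fin (m * n) ≅ Fin m × Fin n are handled as concatenations of m rows.  The edge
-- ⋃_{v ∈ e} {v} × f_v is concat M for the selection M from E₂ over e with row f_v at v ∈ e, ⊥ elsewhere.
options : List (Subset n) → Bool → List (Subset n)
options F true  = F
options F false = [ ⊥ ]

Selection : List (Subset n) → Subset m → Vec (Subset n) m → Set
Selection F = Pointwise (λ b g → g List.∈ options F b)

selections : List (Subset n) → Subset m → List (Vec (Subset n) m)
selections F []      = [ [] ]
selections F (b ∷ e) = cartesianProductWith _∷_ (options F b) (selections F e)

∈-selections⁺ : Selection F e M → M List.∈ selections F e
∈-selections⁺ []       = here refl
∈-selections⁺ (g∈ ∷ S) = ∈-cartesianProductWith⁺ _∷_ g∈ (∈-selections⁺ S)

∈-selections⁻ : (e : Subset m) → M List.∈ selections F e → Selection F e M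
∈-selections⁻ []      (here refl) = []
∈-selections⁻ {F = F} (b ∷ e) M∈
  with _ , _ , g∈ , M∈′ , refl ← ∈-cartesianProductWith⁻ _∷_ (options F b) (selections F e) M∈ =
  g∈ ∷ ∈-selections⁻ e M∈′

length-selections : (F : List (Subset n)) (e : Subset m) → length (selections F e) ≡ length F ^ ∣ e ∣
length-selections F []          = refl
length-selections F (true ∷ e)  =
  trans (length-cartesianProductWith _∷_ F (selections F e)) (cong (length F *_) (length-selections F e))
length-selections F (false ∷ e) =
  trans (length-cartesianProductWith _∷_ [ ⊥ ] (selections F e))
        (trans (+-identityʳ _) (length-selections F e))

selections-unique : Unique F → (e : Subset m) → Unique (selections F e)
selections-unique F! []      = All.[] AllPairs.∷ AllPairs.[]
selections-unique F! (b ∷ e) =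
  Uniqueₚ.cartesianProductWith⁺ _∷_ ∷-injective (options-unique b) (selections-unique F! e)
  where
  options-unique : ∀ b → Unique (options _ b)
  options-unique true  = F!
  options-unique false = All.[] AllPairs.∷ AllPairs.[]

∈-options-injective : {g : Subset n} → ⊥ List.∉ F →
                      ∀ {b b′} → g List.∈ options F b → g List.∈ options F b′ → b ≡ b′
∈-options-injective ⊥∉F {true}  {true}  _           _           = refl
∈-options-injective ⊥∉F {false} {false} _           _           = refl
∈-options-injective ⊥∉F {true}  {false} g∈F         (here refl) = contradiction g∈F ⊥∉F
∈-options-injective ⊥∉F {false} {true}  (here refl) g∈F         = contradiction g∈F ⊥∉F

Selection-injective : ⊥ List.∉ F → Selection F e M → Selection F e′ M → e ≡ e′
Selection-injective ⊥∉F []       []        = refl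
Selection-injective ⊥∉F (g∈ ∷ S) (g∈′ ∷ T) =
  cong₂ _∷_ (∈-options-injective ⊥∉F g∈ g∈′) (Selection-injective ⊥∉F S T)

Selection-lookup : Selection F e M → ∀ {i} → i ∈ e → lookup M i List.∈ F
Selection-lookup (g∈ ∷ S) here        = g∈
Selection-lookup (_  ∷ S) (there i∈e) = Selection-lookup S i∈e

∣concat∣-Selection : ∀ {m n r} {F : List (Subset n)} {e : Subset m} {M : Vec (Subset n) m} →
                     (∀ g → g List.∈ F → ∣ g ∣ ≡ r) → Selection F e M → ∣ concat M ∣ ≡ ∣ e ∣ * r
∣concat∣-Selection ∣F∣≡r [] = refl
∣concat∣-Selection {e = true ∷ _} {M = g ∷ M} ∣F∣≡r (g∈ ∷ S) =
  trans (∣p++q∣≡∣p∣+∣q∣ g (concat M)) (cong₂ _+_ (∣F∣≡r g g∈) (∣concat∣-Selection ∣F∣≡r S))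
∣concat∣-Selection {n = n} {e = false ∷ _} {M = _ ∷ M} ∣F∣≡r (here refl ∷ S) =
  trans (∣p++q∣≡∣p∣+∣q∣ (⊥ {n}) (concat M)) (cong₂ _+_ (∣⊥∣≡0 n) (∣concat∣-Selection ∣F∣≡r S))

Selection-meets : (∀ g h → g List.∈ F → h List.∈ G → Nonempty (g ∩ h)) →
                  Selection F e M → Selection G e′ N → Nonempty (e ∩ e′) → Nonempty (concat M ∩ concat N)
Selection-meets {e = e} {M = M} {e′ = e′} {N = N} F⋈G S T (i , i∈e∩e′)
  with i∈e , i∈e′ ← x∈p∩q⁻ e e′ i∈e∩e′ =
  concat-meets M N i (F⋈G _ _ (Selection-lookup S i∈e) (Selection-lookup T i∈e′))

avoiding-Selection : (R : Vec (Subset n) m) →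
                     (∀ {i} → i ∈ e → ∃ λ g → g List.∈ F × Empty (lookup R i ∩ g)) →
                     ∃ λ M → Selection F e M × Empty (concat R ∩ concat M)
avoiding-Selection {e = []} [] _ = [] , [] , λ ()
avoiding-Selection {e = true ∷ e} (row ∷ R) escape
  with g , g∈F , row∩g-empty ← escape here
     | M , S , R∩M-empty ← avoiding-Selection R (escape ∘ there) =
  g ∷ M , g∈F ∷ S , Empty-∩-++ row∩g-empty R∩M-empty
avoiding-Selection {e = false ∷ e} (row ∷ R) escape
  with M , S , R∩M-empty ← avoiding-Selection R (escape ∘ there) =
  ⊥ ∷ M , here refl ∷ S , Empty-∩-++ row∩⊥-empty R∩M-empty
  where
  row∩⊥-empty : Empty (row ∩ ⊥)
  row∩⊥-empty (_ , i∈row∩⊥) = ∉⊥ (p∩q⊆q row ⊥ i∈row∩⊥)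

rectangle : Subset m → Subset n → Vec (Subset n) m
rectangle p q = Vec.map (λ b → if b then q else ⊥) p

rectangle-Selection : (p : Subset m) {q : Subset n} → Selection [ q ] p (rectangle p q)
rectangle-Selection []          = []
rectangle-Selection (true  ∷ p) = here refl ∷ rectangle-Selection p
rectangle-Selection (false ∷ p) = here refl ∷ rectangle-Selection p

∣rectangle∣ : (p : Subset m) (q : Subset n) → ∣ concat (rectangle p q) ∣ ≡ ∣ p ∣ * ∣ q ∣
∣rectangle∣ p q = ∣concat∣-Selection (λ { _ (here refl) → refl }) (rectangle-Selection p)

module _ {P : Subset n → Set} (P? : Decidable P) where

  rowsSatisfying : Vec (Subset n) m → Subset m
  rowsSatisfying = Vec.map (does ∘ P?)

  ∣rowsSatisfying∣*r≤∣concat∣ : (∀ row → P row → r ≤ ∣ row ∣) →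
                                (R : Vec (Subset n) m) → ∣ rowsSatisfying R ∣ * r ≤ ∣ concat R ∣
  ∣rowsSatisfying∣*r≤∣concat∣ r≤∣row∣ []        = z≤n
  ∣rowsSatisfying∣*r≤∣concat∣ r≤∣row∣ (row ∷ R)
    rewrite ∣p++q∣≡∣p∣+∣q∣ row (concat R) with P? row
  ... | yes Prow = +-mono-≤ (r≤∣row∣ row Prow) (∣rowsSatisfying∣*r≤∣concat∣ r≤∣row∣ R)
  ... | no  _    = m≤n⇒m≤o+n ∣ row ∣ (∣rowsSatisfying∣*r≤∣concat∣ r≤∣row∣ R)

  ∉rowsSatisfying : (R : Vec (Subset n) m) {i : Fin m} → i ∉ rowsSatisfying R → ¬ P (lookup R i)
  ∉rowsSatisfying (row ∷ R) {zero}  i∉ with P? row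
  ... | yes Prow = contradiction here i∉
  ... | no ¬Prow = ¬Prow
  ∉rowsSatisfying (row ∷ R) {suc i} i∉ = ∉rowsSatisfying R (i∉ ∘ there)

module _ (H : Hypergraph) where

  private
    All⇒IsCover : ∀ {C} → All (λ e → Nonempty (C ∩ e)) (edges H) → IsCover H C
    All⇒IsCover all e e∈ = All.lookup all e∈

  isCover? : Decidable (IsCover H)
  isCover? C = Dec.map′ All⇒IsCover (λ cover → All.tabulate (cover _))
                        (all? (λ e → nonempty? (C ∩ e)) (edges H))

  missedEdge : {C : Subset (nV H)} → ¬ IsCover H C → ∃ λ e → e List.∈ edges H × Empty (C ∩ e)
  missedEdge {C} ¬cover =
    find (Allₚ.¬All⇒Any¬ (λ e → nonempty? (C ∩ e)) (edges H) (¬cover ∘ All⇒IsCover))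

Intersecting⇒⊥∉ : (H : Hypergraph) → Intersecting H → ⊥ List.∉ edges H
Intersecting⇒⊥∉ H intersecting ⊥∈ with _ , i∈⊥∩⊥ ← intersecting ⊥ ⊥ ⊥∈ ⊥∈ = ∉⊥ (p∩q⊆p ⊥ ⊥ i∈⊥∩⊥)

productEdgesOver : List (Subset n) → Subset m → List (Subset (m * n))
productEdgesOver E₂ e = List.map concat (selections E₂ e)

productEdges : List (Subset m) → List (Subset n) → List (Subset (m * n))
productEdges E₁ E₂ = concatMap (productEdgesOver E₂) E₁

module _ {E₁ : List (Subset m)} {E₂ : List (Subset n)} where

  ∈-productEdges⁺ : e List.∈ E₁ → Selection E₂ e M → concat M List.∈ productEdges E₁ E₂
  ∈-productEdges⁺ e∈ S = ∈-concatMap⁺ (productEdgesOver E₂) (lose e∈ (∈-map⁺ concat (∈-selections⁺ S)))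

  ∈-productEdges⁻ : {x : Subset (m * n)} → x List.∈ productEdges E₁ E₂ →
                    ∃₂ λ e M → e List.∈ E₁ × Selection E₂ e M × x ≡ concat M
  ∈-productEdges⁻ x∈
    with e , e∈ , x∈over ← find (∈-concatMap⁻ (productEdgesOver E₂) {xs = E₁} x∈)
    with M , M∈ , refl ← ∈-map⁻ concat x∈over =
    e , M , e∈ , ∈-selections⁻ e M∈ , refl

  length-productEdges : (∀ e → e List.∈ E₁ → ∣ e ∣ ≡ r) →
                        length (productEdges E₁ E₂) ≡ length E₁ * length E₂ ^ r
  length-productEdges ∣E₁∣≡r = length-concatMap (productEdgesOver E₂) E₁ λ {e} e∈ →
    trans (length-map concat (selections E₂ e))
          (trans (length-selections E₂ e) (cong (length E₂ ^_) (∣E₁∣≡r e e∈)))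

  -- ⊥ ∉ E₂ is needed: the empty rows of an edge over e are exactly those outside e.
  productEdges-unique : ⊥ List.∉ E₂ → Unique E₁ → Unique E₂ → Unique (productEdges E₁ E₂)
  productEdges-unique ⊥∉E₂ E₁! E₂! =
    Uniqueₚ.concat⁺
      (Allₚ.map⁺ (All.tabulate λ {e} _ → Uniqueₚ.map⁺ (concat-injective _ _) (selections-unique E₂! e)))
      (AllPairsₚ.map⁺ (AllPairs.map disjoint E₁!))
    where
    disjoint : e ≢ e′ → Disjoint (productEdgesOver E₂ e) (productEdgesOver E₂ e′)
    disjoint e≢e′ (x∈ , x∈′)
      with M , M∈ , refl ← ∈-map⁻ concat x∈
         | N , N∈ , eq   ← ∈-map⁻ concat x∈′
      with refl ← concat-injective M N eq =
      e≢e′ (Selection-injective ⊥∉E₂ (∈-selections⁻ _ M∈) (∈-selections⁻ _ N∈))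

module ProductHypergraph (H₁ H₂ : Hypergraph) (⊥∉E₂ : ⊥ List.∉ edges H₂) where

  H : Hypergraph
  H = record
    { nV     = nV H₁ * nV H₂
    ; edges  = productEdges (edges H₁) (edges H₂)
    ; simple = productEdges-unique ⊥∉E₂ (simple H₁) (simple H₂)
    }

  private
    ∈-edges⁻ : {x : Subset (nV H)} → x List.∈ edges H →
               ∃₂ λ e M → e List.∈ edges H₁ × Selection (edges H₂) e M × x ≡ concat M
    ∈-edges⁻ = ∈-productEdges⁻

  uniform : {r₁ r₂ : ℕ} → Uniform r₁ H₁ → Uniform r₂ H₂ → Uniform (r₁ * r₂) H
  uniform {r₂ = r₂} uniform₁ uniform₂ x x∈ with e , M , e∈ , S , refl ← ∈-edges⁻ x∈ =
    trans (∣concat∣-Selection uniform₂ S) (cong (_* r₂) (uniform₁ e e∈))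

  intersecting : Intersecting H₁ → Intersecting H₂ → Intersecting H
  intersecting intersecting₁ intersecting₂ x y x∈ y∈
    with e , M , e∈ , S , refl ← ∈-edges⁻ x∈
       | f , N , f∈ , T , refl ← ∈-edges⁻ y∈ =
    Selection-meets intersecting₂ S T (intersecting₁ e f e∈ f∈)

  rectangle-IsCover : {C₁ : Subset (nV H₁)} {C₂ : Subset (nV H₂)} →
                      IsCover H₁ C₁ → IsCover H₂ C₂ → IsCover H (concat (rectangle C₁ C₂))
  rectangle-IsCover {C₁} cover₁ cover₂ x x∈ with e , M , e∈ , S , refl ← ∈-edges⁻ x∈ =
    Selection-meets (λ { _ h (here refl) h∈ → cover₂ h h∈ }) (rectangle-Selection C₁) S (cover₁ e e∈)

  cover-lowerBound : {r₁ r₂ : ℕ} →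
                     (∀ C → IsCover H₁ C → r₁ ≤ ∣ C ∣) → (∀ C → IsCover H₂ C → r₂ ≤ ∣ C ∣) →
                     ∀ C → IsCover H C → r₁ * r₂ ≤ ∣ C ∣
  cover-lowerBound {r₂ = r₂} lowerBound₁ lowerBound₂ C cover
    with R , refl ← group (nV H₁) (nV H₂) C
    with isCover? H₁ (rowsSatisfying (isCover? H₂) R)
  ... | yes A-covers = ≤-trans (*-monoˡ-≤ r₂ (lowerBound₁ _ A-covers))
                               (∣rowsSatisfying∣*r≤∣concat∣ (isCover? H₂) lowerBound₂ R)
  ... | no ¬A-covers
    with e , e∈ , A∩e-empty ← missedEdge H₁ ¬A-covers
    with M , S , C∩M-empty ← avoiding-Selection R (λ i∈e → missedEdge H₂
           (∉rowsSatisfying (isCover? H₂) R (λ i∈A → A∩e-empty (_ , x∈p∩q⁺ (i∈A , i∈e))))) =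
    contradiction (cover (concat M) (∈-productEdges⁺ e∈ S)) C∩M-empty

  critical : {r₁ r₂ : ℕ} → Critical r₁ H₁ → Critical r₂ H₂ → Critical (r₁ * r₂) H
  critical (uniform₁ , intersecting₁ , (C₁ , cover₁ , ∣C₁∣≡r₁) , lowerBound₁)
           (uniform₂ , intersecting₂ , (C₂ , cover₂ , ∣C₂∣≡r₂) , lowerBound₂) =
    uniform uniform₁ uniform₂ ,
    intersecting intersecting₁ intersecting₂ ,
    (concat (rectangle C₁ C₂) , rectangle-IsCover cover₁ cover₂ ,
     trans (∣rectangle∣ C₁ C₂) (cong₂ _*_ ∣C₁∣≡r₁ ∣C₂∣≡r₂)) ,
    cover-lowerBound lowerBound₁ lowerBound₂

lemma3p2 : (r₁ r₂ : ℕ) (H₁ H₂ : Hypergraph) →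
    Critical r₁ H₁ → Critical r₂ H₂ →
    Σ Hypergraph (λ H → Critical (r₁ * r₂) H
      × ∣V∣ H ≡ ∣V∣ H₁ * ∣V∣ H₂
      × ∣E∣ H ≡ ∣E∣ H₁ * (∣E∣ H₂ ^ r₁))
lemma3p2 r₁ r₂ H₁ H₂ critical₁@(uniform₁ , _) critical₂@(_ , intersecting₂ , _) =
  H , critical critical₁ critical₂ , refl , length-productEdges uniform₁
  where open ProductHypergraph H₁ H₂ (Intersecting⇒⊥∉ H₂ intersecting₂)
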